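{- Let $\alpha,\beta,\gamma,\alpha',\beta',\gamma'\in\mathbb{C}$ and let $T_{n,k}$, $0\le k\le n$, be the GKP triangle with parameters $(\alpha,\beta,\gamma;\alpha',\beta',\gamma')$, with exponential generating function $G(t,z)=\sum_{n\ge0}\sum_{k=0}^n T_{n,k}t^k z^n/n!$. (i) If $\gamma=0$ and $\gamma'\neq0$, then the left-trimmed triangle $T^*_{n,k}:=(\gamma')^{ -1}T_{n+1,k+1}$, $0\le k\le n$, is the GKP triangle with parameters $(\alpha,\beta,\alpha+\beta;\ \alpha',\beta',\alpha'+\beta'+\gamma')$, and its exponential generating function equals $(\gamma')^{ -1}\frac{\partial}{\partial z}G(t,z)/t$. (ii) If $\gamma'=0$ and $\gamma\neq0$, then the right-trimmed triangle $T^*_{n,k}:=\gamma^{ -1}T_{n+1,k}$, $0\le k\le n$, is the GKP triangle with parameters $(\alpha,\beta,\alpha+\gamma;\ \alpha',\beta',\alpha')$, and its exponential generating function equals $\gamma^{ -1}\frac{\partial}{\partial z}G(t,z)$.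
   Context: For complex parameters $(\alpha,\beta,\gamma;\alpha',\beta',\gamma')$, the GKP triangle with these parameters is the unique array of numbers $T_{n,k}$, $0\le k\le n<\infty$ (with the convention $T_{n,k}=0$ if $k<0$ or $k>n$), satisfying $T_{0,0}=1$ and, for all $n\ge0$ and $k\ge-1$, the recurrence $T_{n+1,k+1}=[\alpha n+\beta(k+1)+\gamma]\,T_{n,k+1}+[\alpha' n+\beta' k+\gamma']\,T_{n,k}$. -}

module Defs where

open import Level using (Level; _⊔_) renaming (suc to lsuc)
open import Data.Nat using (ℕ; zero; suc; _≤_; _≤?_)
open import Relation.Nullary using (¬_; yes; no)
open import Algebra.Bundles using (CommutativeRing)

-- A field: a commutative ring with 0 ≠ 1 in which every nonzero element
-- has a multiplicative inverse (agda-stdlib has no Field bundle).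
-- ℂ is an instance; the theorem is stated over an arbitrary field.
record Field (c ℓ : Level) : Set (lsuc (c ⊔ ℓ)) where
  field
    commutativeRing : CommutativeRing c ℓ
  open CommutativeRing commutativeRing public
  field
    0≉1       : ¬ (0# ≈ 1#)
    inv       : (x : Carrier) → ¬ (x ≈ 0#) → Carrier
    inv-right : (x : Carrier) (nz : ¬ (x ≈ 0#)) → x * inv x nz ≈ 1#

module _ {c ℓ : Level} (F : Field c ℓ) where
  open Field F using (Carrier; _≈_; _+_; _*_; 0#; 1#)

  ι : ℕ → Carrier
  ι zero    = 0#
  ι (suc n) = 1# + ι n

  record Params : Set c where
    constructor ⟨_,_,_⨾_,_,_⟩
    field
      α β γ α' β' γ' : Carrier

  -- The GKP triangle T n k with parameters P (T n k = 0 for k > n), i.e. the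
  -- unique array with T 0 0 = 1 and, for n ≥ 0, k ≥ -1,
  -- T (n+1) (k+1) = [α n + β (k+1) + γ] T n (k+1) + [α' n + β' k + γ'] T n k,
  -- where T n (-1) = 0 (this is the case k = -1, giving the first clause for suc n, 0).
  gkp : Params → ℕ → ℕ → Carrier
  gkp P zero    zero    = 1#
  gkp P zero    (suc k) = 0#
  gkp P (suc n) zero    =
    (Params.α P * ι n + Params.γ P) * gkp P n zero
  gkp P (suc n) (suc k) =
    (Params.α P * ι n + Params.β P * ι (suc k) + Params.γ P) * gkp P n (suc k)
    + (Params.α' P * ι n + Params.β' P * ι k + Params.γ' P) * gkp P n k

  -- Formal power series in t (ordinary) and z (exponential):
  -- S n k is the coefficient of t^k z^n / n!.
  Series : Set c
  Series = ℕ → ℕ → Carrier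

  egf : (ℕ → ℕ → Carrier) → Series
  egf T n k with k ≤? n
  ... | yes _ = T n k
  ... | no  _ = 0#

  -- ∂/∂z on exponential series in z: coefficient of z^n/n! becomes that of z^(n+1)/(n+1)!
  ∂z : Series → Series
  ∂z S n k = S (suc n) k

  -- S / t, meaningful when S has no t^0 terms (see divisibleByT)
  divT : Series → Series
  divT S n k = S n (suc k)

  divisibleByT : Series → Set ℓ
  divisibleByT S = ∀ n → S n zero ≈ 0#

  _·_ : Carrier → Series → Series
  (c · S) n k = c * S n k

  _≋_ : Series → Series → Set ℓ
  S ≋ S' = ∀ n k → S n k ≈ S' n k

{-# OPTIONS --safe #-}
module Submission where

open import Defs
open import Level using (Level)
open import Data.Nat using (ℕ; zero; suc; _≤_; _<_; _≤?_; z≤n; s≤s)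
open import Data.Nat.Properties using (≰⇒>; m≤n⇒m≤1+n)
open import Data.Product using (_×_; _,_)
open import Relation.Nullary using (¬_; yes; no)

-- Trimming is a shift of indices, and a shift (n, k) ↦ (n + 1, k + j) turns each affine weight
-- a n + b k + c of the recurrence into a weight with the same slopes and a new constant. The
-- shifted array therefore satisfies a GKP recurrence again once it is known that the trimmed
-- edge vanishes: the first column when γ = 0, the diagonal when γ' = 0. Such an array is its
-- top entry (γ' resp. γ) times the GKP triangle, and the generating-function identities are the
-- bookkeeping of the index shift.

module _ {c ℓ : Level} (F : Field c ℓ) where
  open Field F hiding (zero)
  open import Algebra.Solver.Ring.NaturalCoefficients.Default commutativeSemiring
  open import Relation.Binary.Reasoning.Setoid setoid

  Array : Set c
  Array = ℕ → ℕ → Carrier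

  weight : Carrier → Carrier → Carrier → ℕ → ℕ → Carrier
  weight a b c n k = a * ι F n + b * ι F k + c

  weight-suc : ∀ a b c n k → weight a b c (suc n) (suc k) ≈ weight a b (a + b + c) n k
  weight-suc a b c n k = solve 5
    (λ a b c x y → a :* (con 1 :+ x) :+ b :* (con 1 :+ y) :+ c := a :* x :+ b :* y :+ (a :+ b :+ c))
    refl a b c (ι F n) (ι F k)

  weight-sucˡ : ∀ a b c n k → weight a b c (suc n) k ≈ weight a b (a + c) n k
  weight-sucˡ a b c n k = solve 5
    (λ a b c x y → a :* (con 1 :+ x) :+ b :* y :+ c := a :* x :+ b :* y :+ (a :+ c))
    refl a b c (ι F n) (ι F k)

  combination-of-zeros : ∀ {x y} a b → x ≈ 0# → y ≈ 0# → a * x + b * y ≈ 0#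
  combination-of-zeros a b x≈0 y≈0 = begin
    a * _ + b * _   ≈⟨ +-cong (*-cong refl x≈0) (*-cong refl y≈0) ⟩
    a * 0# + b * 0# ≈⟨ +-cong (zeroʳ a) (zeroʳ b) ⟩
    0# + 0#         ≈⟨ +-identityʳ 0# ⟩
    0#              ∎

  scalar-into-combination : ∀ s x a y b → x * (s * a) + y * (s * b) ≈ s * (x * a + y * b)
  scalar-into-combination = solve 5
    (λ s x a y b → x :* (s :* a) :+ y :* (s :* b) := s :* (x :* a :+ y :* b)) refl

  inv-cancelˡ : ∀ x (nz : ¬ (x ≈ 0#)) y → inv x nz * (x * y) ≈ y
  inv-cancelˡ x nz y = begin
    inv x nz * (x * y) ≈⟨ *-assoc (inv x nz) x y ⟨
    inv x nz * x * y   ≈⟨ *-cong (*-comm (inv x nz) x) refl ⟩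
    x * inv x nz * y   ≈⟨ *-cong (inv-right x nz) refl ⟩
    1# * y             ≈⟨ *-identityˡ y ⟩
    y                  ∎

  module _ (P : Params F) where
    open Params P

    record GKPRecurrence (U : Array) : Set ℓ where
      field
        first-row    : ∀ k → U 0 (suc k) ≈ 0#
        first-column : ∀ n → U (suc n) 0 ≈ (α * ι F n + γ) * U n 0
        interior     : ∀ n k → U (suc n) (suc k)
                         ≈ weight α β γ n (suc k) * U n (suc k) + weight α' β' γ' n k * U n k

    gkp-vanishes-above : ∀ n k → n < k → gkp F P n k ≈ 0#
    gkp-vanishes-above zero    (suc k) _       = refl
    gkp-vanishes-above (suc n) (suc k) (s≤s n<k) = combination-of-zeros _ _
      (gkp-vanishes-above n (suc k) (m≤n⇒m≤1+n n<k)) (gkp-vanishes-above n k n<k)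

    gkp-1-0 : gkp F P 1 0 ≈ γ
    gkp-1-0 = solve 2 (λ a c → (a :* con 0 :+ c) :* con 1 := c) refl α γ

    gkp-1-1 : gkp F P 1 1 ≈ γ'
    gkp-1-1 = solve 6
      (λ a b c a' b' c' → (a :* con 0 :+ b :* (con 1 :+ con 0) :+ c) :* con 0
                          :+ (a' :* con 0 :+ b' :* con 0 :+ c') :* con 1 := c')
      refl α β γ α' β' γ'

    gkp-first-column-vanishes : γ ≈ 0# → ∀ n → gkp F P (suc n) 0 ≈ 0#
    gkp-first-column-vanishes γ≈0 zero    = trans gkp-1-0 γ≈0
    gkp-first-column-vanishes γ≈0 (suc n) =
      trans (*-cong refl (gkp-first-column-vanishes γ≈0 n)) (zeroʳ _)

    module _ {U : Array} (R : GKPRecurrence U) where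
      open GKPRecurrence R

      recurrence-unique : ∀ n k → U n k ≈ U 0 0 * gkp F P n k
      recurrence-unique zero    zero    = sym (*-identityʳ _)
      recurrence-unique zero    (suc k) = trans (first-row k) (sym (zeroʳ _))
      recurrence-unique (suc n) zero    = begin
        U (suc n) 0                         ≈⟨ first-column n ⟩
        x * U n 0                           ≈⟨ *-cong refl (recurrence-unique n 0) ⟩
        x * (U 0 0 * gkp F P n 0)           ≈⟨ *-assoc x (U 0 0) _ ⟨
        x * U 0 0 * gkp F P n 0             ≈⟨ *-cong (*-comm x (U 0 0)) refl ⟩
        U 0 0 * x * gkp F P n 0             ≈⟨ *-assoc (U 0 0) x _ ⟩
        U 0 0 * gkp F P (suc n) 0           ∎
        where x = α * ι F n + γ
      recurrence-unique (suc n) (suc k) = begin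
        U (suc n) (suc k)                   ≈⟨ interior n k ⟩
        x * U n (suc k) + y * U n k         ≈⟨ +-cong (*-cong refl (recurrence-unique n (suc k)))
                                                      (*-cong refl (recurrence-unique n k)) ⟩
        x * (U 0 0 * gkp F P n (suc k)) + y * (U 0 0 * gkp F P n k)
                                            ≈⟨ scalar-into-combination (U 0 0) x _ y _ ⟩
        U 0 0 * gkp F P (suc n) (suc k)     ∎
        where x = weight α β γ n (suc k)
              y = weight α' β' γ' n k

      recurrence-vanishes-above : ∀ n k → n < k → U n k ≈ 0#
      recurrence-vanishes-above n k n<k =
        trans (recurrence-unique n k) (trans (*-cong refl (gkp-vanishes-above n k n<k)) (zeroʳ _))

      recurrence-normalised : ∀ x (nz : ¬ (x ≈ 0#)) → U 0 0 ≈ x →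
                              ∀ n k → inv x nz * U n k ≈ gkp F P n k
      recurrence-normalised x nz U00≈x n k = begin
        inv x nz * U n k                    ≈⟨ *-cong refl (recurrence-unique n k) ⟩
        inv x nz * (U 0 0 * gkp F P n k)    ≈⟨ *-cong refl (*-cong U00≈x refl) ⟩
        inv x nz * (x * gkp F P n k)        ≈⟨ inv-cancelˡ x nz _ ⟩
        gkp F P n k                         ∎

  leftTrimmed : Array → Array
  leftTrimmed T n k = T (suc n) (suc k)

  rightTrimmed : Array → Array
  rightTrimmed T n k = T (suc n) k

  module _ (P : Params F) where
    open Params P

    leftTrimmed-recurrence : γ ≈ 0# →
      GKPRecurrence ⟨ α , β , α + β ⨾ α' , β' , α' + β' + γ' ⟩ (leftTrimmed (gkp F P))
    leftTrimmed-recurrence γ≈0 = record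
      { first-row    = λ k → gkp-vanishes-above P 1 (suc (suc k)) (s≤s (s≤s z≤n))
      ; first-column = λ n → begin
          gkp F P (suc (suc n)) 1
            ≈⟨ +-cong refl (*-cong refl (gkp-first-column-vanishes P γ≈0 n)) ⟩
          weight α β γ (suc n) 1 * gkp F P (suc n) 1 + _ * 0#
            ≈⟨ +-cong (*-cong (+-cong refl γ≈0) refl) (zeroʳ _) ⟩
          weight α β 0# (suc n) 1 * gkp F P (suc n) 1 + 0#
            ≈⟨ +-identityʳ _ ⟩
          weight α β 0# (suc n) 1 * gkp F P (suc n) 1
            ≈⟨ *-cong (first-column-weight n) refl ⟩
          (α * ι F n + (α + β)) * gkp F P (suc n) 1 ∎
      ; interior     = λ n k → +-cong
          (*-cong (trans (weight-suc α β γ n (suc k)) (+-cong refl α+β+γ≈α+β)) refl)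
          (*-cong (weight-suc α' β' γ' n k) refl)
      }
      where
      first-column-weight : ∀ n → weight α β 0# (suc n) 1 ≈ α * ι F n + (α + β)
      first-column-weight n = solve 3
        (λ a b x → a :* (con 1 :+ x) :+ b :* (con 1 :+ con 0) :+ con 0 := a :* x :+ (a :+ b))
        refl α β (ι F n)

      α+β+γ≈α+β : α + β + γ ≈ α + β
      α+β+γ≈α+β = trans (+-cong refl γ≈0) (+-identityʳ _)

    rightTrimmed-recurrence : γ' ≈ 0# →
      GKPRecurrence ⟨ α , β , α + γ ⨾ α' , β' , α' ⟩ (rightTrimmed (gkp F P))
    rightTrimmed-recurrence γ'≈0 = record
      { first-row    = λ where
          zero    → trans (gkp-1-1 P) γ'≈0
          (suc k) → gkp-vanishes-above P 1 (suc (suc k)) (s≤s (s≤s z≤n))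
      ; first-column = λ n → *-cong (first-column-weight n) refl
      ; interior     = λ n k → +-cong
          (*-cong (weight-sucˡ α β γ n (suc k)) refl)
          (*-cong (trans (weight-sucˡ α' β' γ' n k) (+-cong refl α'+γ'≈α')) refl)
      }
      where
      first-column-weight : ∀ n → α * ι F (suc n) + γ ≈ α * ι F n + (α + γ)
      first-column-weight n = solve 3
        (λ a c x → a :* (con 1 :+ x) :+ c := a :* x :+ (a :+ c)) refl α γ (ι F n)

      α'+γ'≈α' : α' + γ' ≈ α'
      α'+γ'≈α' = trans (+-cong refl γ'≈0) (+-identityʳ _)

  egf-≤ : ∀ T n k → k ≤ n → egf F T n k ≈ T n k
  egf-≤ T n k k≤n with k ≤? n
  ... | yes _   = refl
  ... | no  k≰n with () ← k≰n k≤n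

  egf-≰ : ∀ T n k → ¬ (k ≤ n) → egf F T n k ≈ 0#
  egf-≰ T n k k≰n with k ≤? n
  ... | yes k≤n with () ← k≰n k≤n
  ... | no  _   = refl

  egf-scaled-leftTrimmed : ∀ s T →
    _≋_ F (egf F (λ n k → s * leftTrimmed T n k)) (_·_ F s (divT F (∂z F (egf F T))))
  egf-scaled-leftTrimmed s T n k with k ≤? n
  ... | yes k≤n = *-cong refl (sym (egf-≤ T (suc n) (suc k) (s≤s k≤n)))
  ... | no  k≰n = sym (trans (*-cong refl (egf-≰ T (suc n) (suc k) λ { (s≤s k≤n) → k≰n k≤n }))
                             (zeroʳ s))

  -- The entry T (n + 1) (n + 1) is kept by ∂z but dropped by trimming, so it must vanish.
  egf-scaled-rightTrimmed : ∀ s T → (∀ n k → n < k → rightTrimmed T n k ≈ 0#) →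
    _≋_ F (egf F (λ n k → s * rightTrimmed T n k)) (_·_ F s (∂z F (egf F T)))
  egf-scaled-rightTrimmed s T vanishes n k with k ≤? n
  ... | yes k≤n = *-cong refl (sym (egf-≤ T (suc n) k (m≤n⇒m≤1+n k≤n)))
  ... | no  k≰n = sym (trans (*-cong refl egf-vanishes) (zeroʳ s))
    where
    egf-vanishes : egf F T (suc n) k ≈ 0#
    egf-vanishes with k ≤? suc n
    ... | yes _ = vanishes n k (≰⇒> k≰n)
    ... | no  _ = refl

theorem2p1 : ∀ {c ℓ : Level} (F : Field c ℓ) →
  let open Field F in
  (α β γ α' β' γ' : Carrier) →
  let P = ⟨_,_,_⨾_,_,_⟩ {F = F} α β γ α' β' γ'
      T = gkp F P
      G = egf F T
  in ((γ ≈ 0#) → (nz : ¬ (γ' ≈ 0#)) →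
       let T* = λ n k → inv γ' nz * T (suc n) (suc k)
       in (∀ n k → k ≤ n →
             T* n k ≈ gkp F (⟨_,_,_⨾_,_,_⟩ {F = F} α β (α + β) α' β' (α' + β' + γ')) n k)
          × divisibleByT F (∂z F G)
          × _≋_ F (egf F T*) (_·_ F (inv γ' nz) (divT F (∂z F G))))
   × ((γ' ≈ 0#) → (nz : ¬ (γ ≈ 0#)) →
       let T* = λ n k → inv γ nz * T (suc n) k
       in (∀ n k → k ≤ n →
             T* n k ≈ gkp F (⟨_,_,_⨾_,_,_⟩ {F = F} α β (α + γ) α' β' α') n k)
          × _≋_ F (egf F T*) (_·_ F (inv γ nz) (∂z F G)))
theorem2p1 F α β γ α' β' γ' =
    (λ γ≈0 nz → let R = leftTrimmed-recurrence F P γ≈0 in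
        (λ n k _ → recurrence-normalised F _ R γ' nz (gkp-1-1 F P) n k)
      , (λ n → trans (egf-≤ F (gkp F P) (suc n) 0 z≤n) (gkp-first-column-vanishes F P γ≈0 n))
      , egf-scaled-leftTrimmed F (inv γ' nz) (gkp F P))
  , (λ γ'≈0 nz → let R = rightTrimmed-recurrence F P γ'≈0 in
        (λ n k _ → recurrence-normalised F _ R γ nz (gkp-1-0 F P) n k)
      , egf-scaled-rightTrimmed F (inv γ nz) (gkp F P) (recurrence-vanishes-above F _ R))
  where
  open Field F using (trans; inv)

  P : Params F
  P = ⟨_,_,_⨾_,_,_⟩ {F = F} α β γ α' β' γ'
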